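{- Let $D\in\mathcal{C}^0_{\mathrm{clq}}$ and let $A,B,A\cup B,A\cap B\subseteq D$ be induced substructures. Then $\lambda(A\cup B)+\lambda(A\cap B)\le\lambda(A)+\lambda(B)$.
   Context: Fix natural $n\ge2$, $0<r<n$, $s=n-r+1$. $\mathcal{L}=\{T_k:k\ge s\}$ with $T_k$ of arity $rk$, viewed as a relation on $k$ $r$-tuples; all $\mathcal{L}$-structures satisfy: $T_k(\bar x_1,\dots,\bar x_k)$ implies the $\bar x_i$ pairwise distinct, $T_k$ is invariant under permutations of the $\bar x_i$, and $T_k(\bar x_1,\dots,\bar x_k)$ implies $T_i(\bar x_1,\dots,\bar x_i)$ for $s\le i<k$. A clique of $A$ is $K\subseteq A^r$ with $|K|\ge s$ such that any $k\ge s$ distinct elements of $K$ form a tuple in $T_k^A$; $\mathcal{K}(A)$ is the set of maximal cliques (under inclusion). $\mathcal{C}^0_{\mathrm{clq}}$ is the class of finite $\mathcal{L}$-structures $A$ in which any two distinct maximal cliques $K_1,K_2$ satisfy $|K_1\cap K_2|<s$. For a finite set $X$, $\|X\|=\max\{0,|X|-(s-1)\}$; $t(A)=\sum_{K\in\mathcal{K}(A)}\|K\|$ and $\lambda(A)=|A|-t(A)$. -}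

module Defs where

open import Data.Nat using (ℕ; zero; suc; _+_; _∸_; _^_; _≤_; _<_)
open import Data.Nat.Properties using (<⇒≤)
open import Data.Fin using (Fin; inject≤; remQuot)
open import Data.Fin.Subset using (Subset; _∈_; _⊆_; ∣_∣; ⊤; _∩_)
open import Data.Empty using (⊥)
open import Data.Fin.Permutation using (Permutation′; _⟨$⟩ʳ_)
open import Data.Vec using (Vec; []; _∷_; lookup)
open import Data.List using (List; map)
open import Data.Nat.ListAction using (sum)
open import Data.List.Relation.Unary.Unique.Propositional using (Unique)
import Data.List.Membership.Propositional as LM
open import Data.Product using (Σ; _×_; _,_; proj₁; proj₂)
open import Function using (_∘_; _⇔_)
open import Relation.Binary.PropositionalEquality using (_≡_)

sOf : ℕ → ℕ → ℕ
sOf n r = (n ∸ r) + 1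

Tup : ℕ → ℕ → Set
Tup m r = Vec (Fin m) r

-- the m ^ r r-tuples are indexed by Fin (m ^ r) via the mixed-radix
-- (base m) bijection  decode : Fin (m ^ r) → Vec (Fin m) r
decode : ∀ {m} r → Fin (m ^ r) → Tup m r
decode zero    _ = []
decode {m} (suc r) i = proj₁ (remQuot {m} (m ^ r) i) ∷ decode r (proj₂ (remQuot {m} (m ^ r) i))

TupSet : ℕ → ℕ → Set
TupSet m r = Subset (m ^ r)

-- A finite L-structure with universe Fin m, L = {T_k : k ≥ s},
-- T_k a relation on k r-tuples, satisfying the standing axioms.
record Str (s m r : ℕ) : Set₁ where
  field
    T : (k : ℕ) → s ≤ k → (Fin k → Tup m r) → Set
    T-distinct : ∀ {k} (p : s ≤ k) (x : Fin k → Tup m r) → T k p x →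
                 ∀ i j → x i ≡ x j → i ≡ j
    T-perm : ∀ {k} (p : s ≤ k) (x : Fin k → Tup m r) (σ : Permutation′ k) →
             T k p x → T k p (x ∘ (σ ⟨$⟩ʳ_))
    T-down : ∀ {k i} (p : s ≤ k) (q : s ≤ i) (i<k : i < k) (x : Fin k → Tup m r) →
             T k p x → T i q (λ j → x (inject≤ j (<⇒≤ i<k)))

module _ {s m r : ℕ} (D : Str s m r) where
  open Str D

  -- K is a clique of the induced substructure on A ⊆ D
  -- (the relations of the induced substructure are those of D restricted to A)
  record IsClique (A : Subset m) (K : TupSet m r) : Set where
    field
      inA  : ∀ {j} → j ∈ K → ∀ i → lookup (decode r j) i ∈ A
      size : s ≤ ∣ K ∣
      rel  : ∀ k (p : s ≤ k) (x : Fin k → Fin (m ^ r)) →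
             (∀ i j → x i ≡ x j → i ≡ j) → (∀ i → x i ∈ K) →
             T k p (decode r ∘ x)

  IsMaxClique : Subset m → TupSet m r → Set
  IsMaxClique A K = IsClique A K × (∀ K′ → IsClique A K′ → K ⊆ K′ → K′ ⊆ K)

  InClq0 : Set
  InClq0 = ∀ K₁ K₂ → IsMaxClique ⊤ K₁ → IsMaxClique ⊤ K₂ →
           (K₁ ≡ K₂ → ⊥) → ∣ K₁ ∩ K₂ ∣ < s

  ‖_‖ : TupSet m r → ℕ
  ‖ K ‖ = ∣ K ∣ ∸ (s ∸ 1)

  IsT : Subset m → ℕ → Set
  IsT A t = Σ (List (TupSet m r)) λ Ks →
              Unique Ks × (∀ K → (K LM.∈ Ks) ⇔ IsMaxClique A K) × (t ≡ sum (map ‖_‖ Ks))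

-- Every maximal clique K of A extends to a maximal clique K′ of
-- A ∪ B, and K = K′ ∩ Aʳ by maximality, so t(A) ≤ Σ_{K′ ∈ 𝒦(A ∪ B)} ‖K′ ∩ Aʳ‖, and likewise
-- for B. As X ↦ ‖X‖ is supermodular, ‖K′ ∩ Aʳ‖ + ‖K′ ∩ Bʳ‖ ≤ ‖K′‖ + ‖K′ ∩ (A ∩ B)ʳ‖.
-- Finally each K′ ∩ (A ∩ B)ʳ with at least s elements extends to a maximal clique of A ∩ B,
-- and different K′ give different ones: in 𝒞⁰_clq two maximal cliques of D sharing s tuples
-- coincide. Hence t(A) + t(B) ≤ t(A ∪ B) + t(A ∩ B), while |A ∪ B| + |A ∩ B| = |A| + |B|.
-- Being a clique is not decidable here, but the conclusion is a decidable inequality, so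
-- excluded middle for the finitely many candidate cliques may be assumed.
module Submission where

open import Defs
open import Data.Nat.Base using (ℕ)

module TruncatedCardinality where

  open import Data.Fin.Subset using (Subset; inside; outside; _∩_; _∪_; ∣_∣)
  open import Data.Fin.Subset.Properties using (∣p∩q∣≤∣p∣; ∣p∩q∣≤∣q∣)
  open import Data.Nat.Base
  open import Data.Nat.Properties
  open import Data.Nat.Tactic.RingSolver using (solve-∀)
  open import Data.Vec.Base using ([]; _∷_)
  open import Function using (_∘_)
  open import Relation.Binary.PropositionalEquality

  ∸-superadditive : ∀ t a b → (a ∸ t) + (b ∸ t) ≤ (a + b) ∸ t
  ∸-superadditive zero    a       b       = ≤-refl
  ∸-superadditive (suc t) zero    b       = ≤-refl
  ∸-superadditive (suc t) (suc a) zero    rewrite +-identityʳ a | +-identityʳ (a ∸ t) = ≤-refl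
  ∸-superadditive (suc t) (suc a) (suc b) =
    ≤-trans (∸-superadditive t a b) (∸-monoˡ-≤ t (+-monoʳ-≤ a (n≤1+n b)))

  ∸-convex : ∀ t c a b → (c + a ∸ t) + (c + b ∸ t) ≤ (c + a + b ∸ t) + (c ∸ t)
  ∸-convex zero    c       a b = ≤-reflexive (regroup c a b)
    where
    regroup : ∀ c a b → (c + a) + (c + b) ≡ (c + a + b) + c
    regroup = solve-∀
  ∸-convex (suc t) zero    a b rewrite +-identityʳ (a + b ∸ suc t) = ∸-superadditive (suc t) a b
  ∸-convex (suc t) (suc c) a b = ∸-convex t c a b

  m<n⇒m∸[n∸1]≡0 : ∀ {m n} → m < n → m ∸ (n ∸ 1) ≡ 0
  m<n⇒m∸[n∸1]≡0 (s≤s m≤n) = m≤n⇒m∸n≡0 m≤n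

  ∣p∪q∣+∣p∩q∣≡∣p∣+∣q∣ : ∀ {n} (p q : Subset n) → ∣ p ∪ q ∣ + ∣ p ∩ q ∣ ≡ ∣ p ∣ + ∣ q ∣
  ∣p∪q∣+∣p∩q∣≡∣p∣+∣q∣ []            []            = refl
  ∣p∪q∣+∣p∩q∣≡∣p∣+∣q∣ (inside  ∷ p) (inside  ∷ q) = begin
    suc (∣ p ∪ q ∣ + suc ∣ p ∩ q ∣) ≡⟨ cong suc (+-suc ∣ p ∪ q ∣ ∣ p ∩ q ∣) ⟩
    suc (suc (∣ p ∪ q ∣ + ∣ p ∩ q ∣)) ≡⟨ cong (suc ∘ suc) (∣p∪q∣+∣p∩q∣≡∣p∣+∣q∣ p q) ⟩
    suc (suc (∣ p ∣ + ∣ q ∣)) ≡⟨ cong suc (+-suc ∣ p ∣ ∣ q ∣) ⟨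
    suc (∣ p ∣ + suc ∣ q ∣) ∎
    where open ≡-Reasoning
  ∣p∪q∣+∣p∩q∣≡∣p∣+∣q∣ (inside  ∷ p) (outside ∷ q) = cong suc (∣p∪q∣+∣p∩q∣≡∣p∣+∣q∣ p q)
  ∣p∪q∣+∣p∩q∣≡∣p∣+∣q∣ (outside ∷ p) (inside  ∷ q) =
    trans (cong suc (∣p∪q∣+∣p∩q∣≡∣p∣+∣q∣ p q)) (sym (+-suc ∣ p ∣ ∣ q ∣))
  ∣p∪q∣+∣p∩q∣≡∣p∣+∣q∣ (outside ∷ p) (outside ∷ q) = ∣p∪q∣+∣p∩q∣≡∣p∣+∣q∣ p q

  -- Write p and q as p ∩ q plus disjoint remainders a and b; then p ∪ q has size ∣p ∩ q∣ + a + b.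
  ∣∣∸-supermodular : ∀ {n} t (p q : Subset n) →
                     (∣ p ∣ ∸ t) + (∣ q ∣ ∸ t) ≤ (∣ p ∪ q ∣ ∸ t) + (∣ p ∩ q ∣ ∸ t)
  ∣∣∸-supermodular t p q = begin
    (∣ p ∣ ∸ t) + (∣ q ∣ ∸ t)        ≡⟨ cong₂ (λ x y → (x ∸ t) + (y ∸ t)) c+a≡∣p∣ c+b≡∣q∣ ⟨
    (c + a ∸ t) + (c + b ∸ t)        ≤⟨ ∸-convex t c a b ⟩
    (c + a + b ∸ t) + (c ∸ t)        ≡⟨ cong (λ z → (z ∸ t) + (c ∸ t)) c+a+b≡∣p∪q∣ ⟩
    (∣ p ∪ q ∣ ∸ t) + (∣ p ∩ q ∣ ∸ t) ∎
    where
    open ≤-Reasoning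
    interleave : ∀ x y z → x + y + z + x ≡ (x + y) + (x + z)
    interleave = solve-∀
    c = ∣ p ∩ q ∣
    a = ∣ p ∣ ∸ c
    b = ∣ q ∣ ∸ c
    c+a≡∣p∣ : c + a ≡ ∣ p ∣
    c+a≡∣p∣ = m+[n∸m]≡n (∣p∩q∣≤∣p∣ p q)
    c+b≡∣q∣ : c + b ≡ ∣ q ∣
    c+b≡∣q∣ = m+[n∸m]≡n (∣p∩q∣≤∣q∣ p q)
    c+a+b≡∣p∪q∣ : c + a + b ≡ ∣ p ∪ q ∣
    c+a+b≡∣p∪q∣ = +-cancelʳ-≡ c _ _
      (trans (interleave c a b) (trans (cong₂ _+_ c+a≡∣p∣ c+b≡∣q∣) (sym (∣p∪q∣+∣p∩q∣≡∣p∣+∣q∣ p q))))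

module ListSums where

  open import Data.Empty using (⊥-elim)
  open import Data.List.Base using ([]; _∷_; _++_; [_]; map)
  open import Data.List.Membership.Propositional using (_∈_)
  open import Data.List.Membership.Propositional.Properties using (∈-∃++)
  open import Data.List.Relation.Binary.Permutation.Propositional.Properties
    using (shift; ∈-resp-↭; map⁺)
  import Data.List.Relation.Unary.All as All
  open import Data.List.Relation.Unary.AllPairs using (_∷_)
  open import Data.List.Relation.Unary.Any using (here; there)
  open import Data.List.Relation.Unary.Unique.Propositional using (Unique)
  open import Data.Nat.Base
  open import Data.Nat.ListAction using (sum)
  open import Data.Nat.ListAction.Properties using (sum-↭)
  open import Data.Nat.Properties
  open import Algebra.Properties.CommutativeSemigroup +-commutativeSemigroup
    using () renaming (interchange to +-interchange)
  open import Data.Product using (∃-syntax; _×_; _,_)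
  open import Data.Sum using (_⊎_; inj₁; inj₂)
  open import Function using (_∘_)
  open import Relation.Binary.PropositionalEquality using (_≡_; refl; cong; module ≡-Reasoning)

  module _ {a} {A : Set a} where

    sum-map-+ : ∀ (f g : A → ℕ) xs →
                sum (map (λ x → f x + g x) xs) ≡ sum (map f xs) + sum (map g xs)
    sum-map-+ f g []       = refl
    sum-map-+ f g (x ∷ xs) = begin
      (f x + g x) + sum (map (λ x → f x + g x) xs)      ≡⟨ cong (f x + g x +_) (sum-map-+ f g xs) ⟩
      (f x + g x) + (sum (map f xs) + sum (map g xs))   ≡⟨ +-interchange (f x) (g x) (sum (map f xs)) _ ⟩
      (f x + sum (map f xs)) + (g x + sum (map g xs))   ∎
      where open ≡-Reasoning

    sum-map-mono-≤ : ∀ {f g : A → ℕ} → (∀ x → f x ≤ g x) → ∀ xs → sum (map f xs) ≤ sum (map g xs)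
    sum-map-mono-≤ f≤g []       = z≤n
    sum-map-mono-≤ f≤g (x ∷ xs) = +-mono-≤ (f≤g x) (sum-map-mono-≤ f≤g xs)

  module _ {a b r} {A : Set a} {B : Set b} (w : A → ℕ) (v : B → ℕ) (R : A → B → Set r) where

    sum-map-≤-injection : ∀ {xs ys} → Unique xs →
      (∀ {x} → x ∈ xs → w x ≡ 0 ⊎ ∃[ y ] (y ∈ ys × R x y × w x ≤ v y)) →
      (∀ {x x′ y} → x ∈ xs → x′ ∈ xs → R x y → R x′ y → x ≡ x′) →
      sum (map w xs) ≤ sum (map v ys)
    sum-map-≤-injection {[]}     _                 _     _   = z≤n
    sum-map-≤-injection {x ∷ xs} (x∉xs ∷ unique) cover injective with cover (here refl)
    ... | inj₁ wx≡0 rewrite wx≡0 =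
      sum-map-≤-injection unique (cover ∘ there) (λ p q → injective (there p) (there q))
    ... | inj₂ (y , y∈ys , Rxy , wx≤vy) with pre , post , refl ← ∈-∃++ y∈ys = begin
      w x + sum (map w xs)
        ≤⟨ +-mono-≤ wx≤vy (sum-map-≤-injection unique cover′ (λ p q → injective (there p) (there q))) ⟩
      v y + sum (map v (pre ++ post))
        ≡⟨ sum-↭ (map⁺ v (shift y pre post)) ⟨
      sum (map v (pre ++ [ y ] ++ post)) ∎
      where
      open ≤-Reasoning
      cover′ : ∀ {x′} → x′ ∈ xs → w x′ ≡ 0 ⊎ ∃[ y′ ] (y′ ∈ pre ++ post × R x′ y′ × w x′ ≤ v y′)
      cover′ x′∈xs with cover (there x′∈xs)
      ... | inj₁ wx′≡0 = inj₁ wx′≡0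
      ... | inj₂ (y′ , y′∈ys , Rx′y′ , le) with ∈-resp-↭ (shift y pre post) y′∈ys
      ...   | there y′∈rest = inj₂ (y′ , y′∈rest , Rx′y′ , le)
      ...   | here refl     =
        ⊥-elim (All.lookup x∉xs x′∈xs (injective (here refl) (there x′∈xs) Rxy Rx′y′))

module ExcludedMiddle where

  open import Data.Fin.Subset using (Subset; inside; outside)
  open import Data.Nat.Base using (zero; suc)
  open import Data.Vec.Base using ([]; _∷_)
  open import Relation.Nullary using (¬_; Dec)
  open import Relation.Nullary.Decidable using (¬¬-excluded-middle)

  ¬¬-decidable : ∀ {n} (P : Subset n → Set) → ¬ ¬ (∀ p → Dec (P p))
  ¬¬-decidable {zero}  P k = ¬¬-excluded-middle λ P[]? → k λ { [] → P[]? }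
  ¬¬-decidable {suc n} P k =
    ¬¬-decidable (λ p → P (outside ∷ p)) λ P-outside? →
    ¬¬-decidable (λ p → P (inside ∷ p)) λ P-inside? →
    k λ { (outside ∷ p) → P-outside? p ; (inside ∷ p) → P-inside? p }

module MaximalCliques {s m r : ℕ} (D : Str s m r) where

  open import Data.Bool.Properties using (T-≡) renaming (_≟_ to _≟ᴮ_)
  open import Data.Fin.Base using (Fin)
  open import Data.Fin.Properties using (all?)
  open import Data.Fin.Subset using (Subset; _∈_; _⊆_; _⊃_; ⊤; _∩_; _∪_; ∣_∣)
  open import Data.Fin.Subset.Properties
  open import Data.Fin.Subset.Induction using (⊃-wellFounded)
  open import Data.List.Base using (List; map)
  open import Data.List.Membership.Propositional using () renaming (_∈_ to _∈ₗ_)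
  open import Data.List.Relation.Unary.Unique.Propositional using (Unique)
  open import Data.Nat.Base
  open import Data.Nat.ListAction using (sum)
  open import Data.Nat.Properties
  open import Data.Product using (∃-syntax; _×_; _,_; proj₁)
  open import Data.Sum using (_⊎_; inj₁; inj₂)
  open import Data.Vec.Base using (lookup; tabulate)
  open import Data.Vec.Properties using (lookup⇒[]=; []=⇒lookup; lookup∘tabulate; ≡-dec)
  open import Function using (_∘_; _⇔_)
  open import Function.Bundles using (Equivalence)
  open import Induction.WellFounded using (Acc; acc)
  open import Relation.Nullary using (Dec; yes; no)
  open import Relation.Nullary.Decidable
    using (isYes; fromWitness; toWitness; map′; _×-dec_; decidable-stable)
  open import Relation.Binary.PropositionalEquality
  open Equivalence using (to; from)
  open TruncatedCardinality
  open ListSums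

  EntriesIn : Subset m → Fin (m ^ r) → Set
  EntriesIn X j = ∀ i → lookup (decode r j) i ∈ X

  entriesIn? : ∀ X j → Dec (EntriesIn X j)
  entriesIn? X j = all? λ i → lookup (decode r j) i ∈? X

  tuplesIn : Subset m → TupSet m r
  tuplesIn X = tabulate (isYes ∘ entriesIn? X)

  ∈-tuplesIn⁺ : ∀ {X j} → EntriesIn X j → j ∈ tuplesIn X
  ∈-tuplesIn⁺ {X} {j} h =
    lookup⇒[]= j (tuplesIn X) (trans (lookup∘tabulate _ j) (to T-≡ (fromWitness h)))

  ∈-tuplesIn⁻ : ∀ {X j} → j ∈ tuplesIn X → EntriesIn X j
  ∈-tuplesIn⁻ {X} {j} j∈ =
    toWitness (from T-≡ (trans (sym (lookup∘tabulate (isYes ∘ entriesIn? X) j)) ([]=⇒lookup j∈)))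

  tuplesIn-∩ : ∀ X Y → tuplesIn X ∩ tuplesIn Y ⊆ tuplesIn (X ∩ Y)
  tuplesIn-∩ X Y j∈ with j∈X , j∈Y ← x∈p∩q⁻ _ _ j∈ =
    ∈-tuplesIn⁺ λ i → x∈p∩q⁺ (∈-tuplesIn⁻ j∈X i , ∈-tuplesIn⁻ j∈Y i)

  clique⊆tuplesIn : ∀ {X K} → IsClique D X K → K ⊆ tuplesIn X
  clique⊆tuplesIn c j∈K = ∈-tuplesIn⁺ (IsClique.inA c j∈K)

  subclique : ∀ {X Y K K′} → K ⊆ tuplesIn X → s ≤ ∣ K ∣ → K ⊆ K′ → IsClique D Y K′ → IsClique D X K
  subclique K⊆Xʳ s≤∣K∣ K⊆K′ c′ = record
    { inA  = ∈-tuplesIn⁻ ∘ K⊆Xʳ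
    ; size = s≤∣K∣
    ; rel  = λ k p x distinct x∈K → IsClique.rel c′ k p x distinct (K⊆K′ ∘ x∈K)
    }

  IsClique-mono : ∀ {X Y K} → X ⊆ Y → IsClique D X K → IsClique D Y K
  IsClique-mono X⊆Y c = record
    { inA  = λ j∈K i → X⊆Y (IsClique.inA c j∈K i)
    ; size = IsClique.size c
    ; rel  = IsClique.rel c
    }

  maximal≡restriction : ∀ {X Y K K′} → IsMaxClique D X K → K ⊆ K′ → IsClique D Y K′ →
                        K ≡ K′ ∩ tuplesIn X
  maximal≡restriction {X} {K = K} {K′} (c , maximal) K⊆K′ c′ =
    ⊆-antisym K⊆K′∩Xʳ (maximal _ (subclique (p∩q⊆q _ _) s≤∣K′∩Xʳ∣ (p∩q⊆p _ _) c′) K⊆K′∩Xʳ)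
    where
    K⊆K′∩Xʳ : K ⊆ K′ ∩ tuplesIn X
    K⊆K′∩Xʳ j∈K = x∈p∩q⁺ (K⊆K′ j∈K , clique⊆tuplesIn c j∈K)
    s≤∣K′∩Xʳ∣ : s ≤ ∣ K′ ∩ tuplesIn X ∣
    s≤∣K′∩Xʳ∣ = ≤-trans (IsClique.size c) (p⊆q⇒∣p∣≤∣q∣ K⊆K′∩Xʳ)

  InClq0⇒maximal-≡ : InClq0 D → ∀ {K M₁ M₂} → IsMaxClique D ⊤ M₁ → IsMaxClique D ⊤ M₂ →
                     s ≤ ∣ K ∣ → K ⊆ M₁ → K ⊆ M₂ → M₁ ≡ M₂
  InClq0⇒maximal-≡ clq {K} {M₁} {M₂} max₁ max₂ s≤∣K∣ K⊆M₁ K⊆M₂ =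
    decidable-stable (≡-dec _≟ᴮ_ M₁ M₂) λ M₁≢M₂ →
      <⇒≱ (clq M₁ M₂ max₁ max₂ M₁≢M₂)
          (≤-trans s≤∣K∣ (p⊆q⇒∣p∣≤∣q∣ λ j∈K → x∈p∩q⁺ (K⊆M₁ j∈K , K⊆M₂ j∈K)))

  ‖_‖ᴰ : TupSet m r → ℕ
  ‖_‖ᴰ = ‖_‖ D

  ‖‖ᴰ-mono : ∀ {K K′} → K ⊆ K′ → ‖ K ‖ᴰ ≤ ‖ K′ ‖ᴰ
  ‖‖ᴰ-mono = ∸-monoˡ-≤ (s ∸ 1) ∘ p⊆q⇒∣p∣≤∣q∣

  ‖‖ᴰ-restriction-supermodular : ∀ A B K →
    ‖ K ∩ tuplesIn A ‖ᴰ + ‖ K ∩ tuplesIn B ‖ᴰ ≤ ‖ K ‖ᴰ + ‖ K ∩ tuplesIn (A ∩ B) ‖ᴰ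
  ‖‖ᴰ-restriction-supermodular A B K =
    ≤-trans (∣∣∸-supermodular (s ∸ 1) (K ∩ tuplesIn A) (K ∩ tuplesIn B))
            (+-mono-≤ (‖‖ᴰ-mono ∪⊆K) (‖‖ᴰ-mono ∩⊆K∩[A∩B]ʳ))
    where
    ∪⊆K : K ∩ tuplesIn A ∪ K ∩ tuplesIn B ⊆ K
    ∪⊆K j∈ with x∈p∪q⁻ _ _ j∈
    ... | inj₁ j∈K∩Aʳ = p∩q⊆p _ _ j∈K∩Aʳ
    ... | inj₂ j∈K∩Bʳ = p∩q⊆p _ _ j∈K∩Bʳ
    ∩⊆K∩[A∩B]ʳ : (K ∩ tuplesIn A) ∩ (K ∩ tuplesIn B) ⊆ K ∩ tuplesIn (A ∩ B)
    ∩⊆K∩[A∩B]ʳ j∈ with j∈K∩Aʳ , j∈K∩Bʳ ← x∈p∩q⁻ _ _ j∈ =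
      x∈p∩q⁺ (p∩q⊆p _ _ j∈K∩Aʳ , tuplesIn-∩ A B (x∈p∩q⁺ (p∩q⊆q _ _ j∈K∩Aʳ , p∩q⊆q _ _ j∈K∩Bʳ)))

  Enumerates : Subset m → List (TupSet m r) → Set
  Enumerates X Ks = ∀ K → (K ∈ₗ Ks) ⇔ IsMaxClique D X K

  module _ (clique? : ∀ K → Dec (IsClique D ⊤ K)) where

    isClique? : ∀ X K → Dec (IsClique D X K)
    isClique? X K = map′ from⊤ to⊤ (clique? K ×-dec K ⊆? tuplesIn X)
      where
      from⊤ : IsClique D ⊤ K × K ⊆ tuplesIn X → IsClique D X K
      from⊤ (c , K⊆Xʳ) = subclique K⊆Xʳ (IsClique.size c) ⊆-refl c
      to⊤ : IsClique D X K → IsClique D ⊤ K × K ⊆ tuplesIn X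
      to⊤ c = IsClique-mono ⊆⊤ c , clique⊆tuplesIn c

    extendToMaximal : ∀ {X K} → IsClique D X K → ∃[ K* ] (K ⊆ K* × IsMaxClique D X K*)
    extendToMaximal {X} {K} = go (⊃-wellFounded K)
      where
      go : ∀ {K} → Acc _⊃_ K → IsClique D X K → ∃[ K* ] (K ⊆ K* × IsMaxClique D X K*)
      go {K} (acc larger) c with anySubset? (λ K′ → K ⊂? K′ ×-dec isClique? X K′)
      ... | yes (K′ , K⊂K′ , c′) with K* , K′⊆K* , max ← go (larger K⊂K′) c′ =
        K* , ⊆-trans (p⊂q⇒p⊆q K⊂K′) K′⊆K* , max
      ... | no no-larger = K , ⊆-refl , c , maximal
        where
        maximal : ∀ K′ → IsClique D X K′ → K ⊆ K′ → K′ ⊆ K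
        maximal K′ c′ K⊆K′ {j} j∈K′ =
          decidable-stable (j ∈? K) λ j∉K → no-larger (K′ , (K⊆K′ , j , j∈K′ , j∉K) , c′)

    sum‖‖ᴰ≤sum‖∩tuplesIn‖ᴰ : ∀ {X Y KsX KsY} → X ⊆ Y → Unique KsX →
      Enumerates X KsX → Enumerates Y KsY →
      sum (map ‖_‖ᴰ KsX) ≤ sum (map (λ K → ‖ K ∩ tuplesIn X ‖ᴰ) KsY)
    sum‖‖ᴰ≤sum‖∩tuplesIn‖ᴰ {X} {Y} {KsX} {KsY} X⊆Y unique enumX enumY =
      sum-map-≤-injection _ _ Extends unique cover injective
      where
      Extends : TupSet m r → TupSet m r → Set
      Extends KX KY = KX ⊆ KY × IsClique D Y KY

      cover : ∀ {KX} → KX ∈ₗ KsX → ‖ KX ‖ᴰ ≡ 0 ⊎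
              ∃[ KY ] (KY ∈ₗ KsY × Extends KX KY × ‖ KX ‖ᴰ ≤ ‖ KY ∩ tuplesIn X ‖ᴰ)
      cover {KX} KX∈
        with maxX ← to (enumX KX) KX∈
        with KY , KX⊆KY , maxY ← extendToMaximal (IsClique-mono X⊆Y (proj₁ maxX)) =
        inj₂ (KY , from (enumY KY) maxY , (KX⊆KY , proj₁ maxY) ,
              ≤-reflexive (cong ‖_‖ᴰ (maximal≡restriction maxX KX⊆KY (proj₁ maxY))))

      injective : ∀ {K₁ K₂ KY} → K₁ ∈ₗ KsX → K₂ ∈ₗ KsX → Extends K₁ KY → Extends K₂ KY → K₁ ≡ K₂
      injective K₁∈ K₂∈ (K₁⊆KY , cY) (K₂⊆KY , _) =
        trans (maximal≡restriction (to (enumX _) K₁∈) K₁⊆KY cY)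
              (sym (maximal≡restriction (to (enumX _) K₂∈) K₂⊆KY cY))

    sum‖∩tuplesIn‖ᴰ≤sum‖‖ᴰ : InClq0 D → ∀ {Y Z KsY KsZ} → Unique KsY →
      Enumerates Y KsY → Enumerates Z KsZ →
      sum (map (λ K → ‖ K ∩ tuplesIn Z ‖ᴰ) KsY) ≤ sum (map ‖_‖ᴰ KsZ)
    sum‖∩tuplesIn‖ᴰ≤sum‖‖ᴰ clq {Y} {Z} {KsY} {KsZ} unique enumY enumZ =
      sum-map-≤-injection _ _ Covers unique cover injective
      where
      Covers : TupSet m r → TupSet m r → Set
      Covers KY KZ = s ≤ ∣ KY ∩ tuplesIn Z ∣ × KY ∩ tuplesIn Z ⊆ KZ × IsClique D Z KZ

      cover : ∀ {KY} → KY ∈ₗ KsY → ‖ KY ∩ tuplesIn Z ‖ᴰ ≡ 0 ⊎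
              ∃[ KZ ] (KZ ∈ₗ KsZ × Covers KY KZ × ‖ KY ∩ tuplesIn Z ‖ᴰ ≤ ‖ KZ ‖ᴰ)
      cover {KY} KY∈ with s ≤? ∣ KY ∩ tuplesIn Z ∣
      ... | no  small = inj₁ (m<n⇒m∸[n∸1]≡0 (≰⇒> small))
      ... | yes large
        with KZ , ⊆KZ , maxZ ←
               extendToMaximal (subclique (p∩q⊆q _ _) large (p∩q⊆p _ _) (proj₁ (to (enumY KY) KY∈))) =
        inj₂ (KZ , from (enumZ KZ) maxZ , (large , ⊆KZ , proj₁ maxZ) , ‖‖ᴰ-mono ⊆KZ)

      -- Both preimages of KZ are the restriction to Yʳ of the maximal clique of D containing KZ.
      injective : ∀ {K₁ K₂ KZ} → K₁ ∈ₗ KsY → K₂ ∈ₗ KsY → Covers K₁ KZ → Covers K₂ KZ → K₁ ≡ K₂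
      injective {KZ = KZ} K₁∈ K₂∈ (large₁ , ⊆KZ₁ , cZ) (large₂ , ⊆KZ₂ , _) =
        trans (≡restriction K₁∈ large₁ ⊆KZ₁) (sym (≡restriction K₂∈ large₂ ⊆KZ₂))
        where
        maximalAboveKZ : ∃[ M ] (KZ ⊆ M × IsMaxClique D ⊤ M)
        maximalAboveKZ = extendToMaximal (IsClique-mono ⊆⊤ cZ)
        ≡restriction : ∀ {K} → K ∈ₗ KsY → s ≤ ∣ K ∩ tuplesIn Z ∣ → K ∩ tuplesIn Z ⊆ KZ →
                       K ≡ proj₁ maximalAboveKZ ∩ tuplesIn Y
        ≡restriction {K} K∈ large ⊆KZ
          with maxY ← to (enumY K) K∈
          with MK , K⊆MK , maxMK ← extendToMaximal (IsClique-mono ⊆⊤ (proj₁ maxY))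
          with M , KZ⊆M , maxM ← maximalAboveKZ =
          trans (maximal≡restriction maxY K⊆MK (proj₁ maxMK))
                (cong (_∩ tuplesIn Y)
                      (InClq0⇒maximal-≡ clq maxMK maxM large
                        (⊆-trans (p∩q⊆p _ _) K⊆MK) (⊆-trans ⊆KZ KZ⊆M)))

    t-supermodular : InClq0 D → ∀ {A B tA tB tU tI} →
      IsT D A tA → IsT D B tB → IsT D (A ∪ B) tU → IsT D (A ∩ B) tI → tA + tB ≤ tU + tI
    t-supermodular clq {A} {B}
      (KsA , uniqueA , enumA , refl) (KsB , uniqueB , enumB , refl)
      (KsU , uniqueU , enumU , refl) (KsI , _       , enumI , refl) = begin
      sum (map ‖_‖ᴰ KsA) + sum (map ‖_‖ᴰ KsB)
        ≤⟨ +-mono-≤ (sum‖‖ᴰ≤sum‖∩tuplesIn‖ᴰ (p⊆p∪q B) uniqueA enumA enumU)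
                    (sum‖‖ᴰ≤sum‖∩tuplesIn‖ᴰ (q⊆p∪q A B) uniqueB enumB enumU) ⟩
      sum (map ‖∩ A ‖ KsU) + sum (map ‖∩ B ‖ KsU)
        ≡⟨ sum-map-+ ‖∩ A ‖ ‖∩ B ‖ KsU ⟨
      sum (map (λ K → ‖∩ A ‖ K + ‖∩ B ‖ K) KsU)
        ≤⟨ sum-map-mono-≤ (‖‖ᴰ-restriction-supermodular A B) KsU ⟩
      sum (map (λ K → ‖ K ‖ᴰ + ‖∩ A ∩ B ‖ K) KsU)
        ≡⟨ sum-map-+ ‖_‖ᴰ ‖∩ A ∩ B ‖ KsU ⟩
      sum (map ‖_‖ᴰ KsU) + sum (map ‖∩ A ∩ B ‖ KsU)
        ≤⟨ +-monoʳ-≤ _ (sum‖∩tuplesIn‖ᴰ≤sum‖‖ᴰ clq uniqueU enumU enumI) ⟩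
      sum (map ‖_‖ᴰ KsU) + sum (map ‖_‖ᴰ KsI) ∎
      where
      open ≤-Reasoning
      ‖∩_‖ : Subset m → TupSet m r → ℕ
      ‖∩ X ‖ K = ‖ K ∩ tuplesIn X ‖ᴰ

module IntegerDifferences where

  open import Data.Integer.Base using (+_; _-_; _+_; _≤_; +≤+)
  import Data.Integer.Properties as ℤ
  open import Data.Integer.Tactic.RingSolver using (solve-∀)
  import Data.Nat.Base as ℕ
  open import Relation.Binary.PropositionalEquality

  [a-t]+[b-u]≤[c-v]+[d-w] : ∀ {a b c d t u v w} → a ℕ.+ b ≡ c ℕ.+ d → v ℕ.+ w ℕ.≤ t ℕ.+ u →
                            (+ a - + t) + (+ b - + u) ≤ (+ c - + v) + (+ d - + w)
  [a-t]+[b-u]≤[c-v]+[d-w] {a} {b} {c} {d} {t} {u} {v} {w} a+b≡c+d v+w≤t+u = begin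
    (+ a - + t) + (+ b - + u)   ≡⟨ regroup (+ a) (+ b) (+ t) (+ u) ⟩
    + (a ℕ.+ b) - + (t ℕ.+ u)   ≡⟨ cong (λ x → + x - + (t ℕ.+ u)) a+b≡c+d ⟩
    + (c ℕ.+ d) - + (t ℕ.+ u)   ≤⟨ ℤ.+-monoʳ-≤ (+ (c ℕ.+ d)) (ℤ.neg-mono-≤ (+≤+ v+w≤t+u)) ⟩
    + (c ℕ.+ d) - + (v ℕ.+ w)   ≡⟨ regroup (+ c) (+ d) (+ v) (+ w) ⟨
    (+ c - + v) + (+ d - + w)   ∎
    where
    open ℤ.≤-Reasoning
    regroup : ∀ x y z z′ → (x - z) + (y - z′) ≡ (x + y) - (z + z′)
    regroup = solve-∀

open import Data.Nat.Base using (_<_; _≤_)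
open import Data.Integer using (+_; _-_; _+_) renaming (_≤_ to _≤ℤ_)
open import Data.Integer.Properties using () renaming (_≤?_ to _≤ℤ?_)
open import Data.Fin.Subset using (Subset; _∪_; _∩_; ∣_∣; ⊤)
open import Relation.Nullary.Decidable using (decidable-stable)
open TruncatedCardinality using (∣p∪q∣+∣p∩q∣≡∣p∣+∣q∣)
open ExcludedMiddle using (¬¬-decidable)
open MaximalCliques using (t-supermodular)
open IntegerDifferences using ([a-t]+[b-u]≤[c-v]+[d-w])

lemma2p7 : (n r : ℕ) → 2 ≤ n → 0 < r → r < n →
    (m : ℕ) (D : Str (sOf n r) m r) → InClq0 D →
    (A B : Subset m) (tA tB tU tI : ℕ) →
    IsT D A tA → IsT D B tB → IsT D (A ∪ B) tU → IsT D (A ∩ B) tI →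
    ((+ ∣ A ∪ B ∣ - + tU) + (+ ∣ A ∩ B ∣ - + tI)) ≤ℤ ((+ ∣ A ∣ - + tA) + (+ ∣ B ∣ - + tB))
lemma2p7 n r _ _ _ m D clq A B tA tB tU tI isTA isTB isTU isTI =
  decidable-stable (_ ≤ℤ? _) λ ¬goal →
    ¬¬-decidable (IsClique D ⊤) λ clique? →
      ¬goal ([a-t]+[b-u]≤[c-v]+[d-w] {t = tU} {tI} {tA} {tB} (∣p∪q∣+∣p∩q∣≡∣p∣+∣q∣ A B)
               (t-supermodular D clique? clq isTA isTB isTU isTI))
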